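{- Let $\mathcal{A}$ be a finite alphabet, $w\in\mathcal{A}^+$, and let $\mathcal{C},\mathcal{K},\mathcal{R},\mathcal{M},\mathcal{U},\mathcal{N}$ be respectively the autocorrelation set, the prefix code $\mathcal{C}_\circ\setminus\mathcal{C}_\circ\mathcal{A}^+$, and the right, minimal, ultimate and not languages of $w$. Then \[ \mathcal{A}^{\star}=\mathcal{N}\ \cup\ (\mathcal{R}w^{ - })\,(w\mathcal{C}^{\star})\,\Big(\big((\mathcal{M}\setminus\mathcal{K})w^{ - }\big)\,(w\mathcal{C}^{\star})\Big)^{\star}\,\mathcal{U}. \]
   Context: $\epsilon$ is the empty word, $\mathcal{A}^+=\mathcal{A}^\star\setminus\{\epsilon\}$. Autocorrelation set: $\mathcal{C}=\{e\in\mathcal{A}^\star: |e|<|w|,\ we\in\mathcal{A}^\star w\}$ (contains $\epsilon$); $\mathcal{C}_\circ=\mathcal{C}\setminus\{\epsilon\}$; $\mathcal{K}=\mathcal{C}_\circ\setminus\mathcal{C}_\circ\mathcal{A}^+$. Right language: $\mathcal{R}=\{r\in\mathcal{A}^\star w: w \text{ occurs in } r \text{ only as a suffix}\}$. Minimal language: $\mathcal{M}=\{m\in\mathcal{A}^+: wm\in\mathcal{A}^\star w \text{ and the only occurrences of } w \text{ in } wm \text{ are as prefix and as suffix}\}$. Ultimate language: $\mathcal{U}=\{u\in\mathcal{A}^\star: \text{the only occurrence of } w \text{ in } wu \text{ is as its prefix}\}$. Not language: $\mathcal{N}=\{n\in\mathcal{A}^\star: w \text{ does not occur in } n\}$. For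 a language $\mathcal{L}$, the residual is $\mathcal{L}w^{ - }=\{x: xw\in\mathcal{L}\}$. Concatenation of languages is elementwise and $\mathcal{L}^\star$ is the Kleene star. -}

module Defs where

open import Data.Nat using (ℕ; _<_)
open import Data.Fin using (Fin)
open import Data.List using (List; []; _∷_; _++_; length)
open import Data.Product using (Σ; ∃; ∃-syntax; _×_; _,_)
open import Data.Sum using (_⊎_)
open import Data.Unit using (⊤)
open import Relation.Nullary using (¬_)
open import Relation.Binary.PropositionalEquality using (_≡_; _≢_)

Word : ℕ → Set
Word q = List (Fin q)

Lang : ℕ → Set₁
Lang q = Word q → Set

module _ {q : ℕ} where

  Full : Lang q
  Full _ = ⊤

  Sing : Word q → Lang q
  Sing w x = x ≡ w

  _∪_ : Lang q → Lang q → Lang q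
  (L ∪ L') x = L x ⊎ L' x

  _∖_ : Lang q → Lang q → Lang q
  (L ∖ L') x = L x × ¬ L' x

  _·_ : Lang q → Lang q → Lang q
  (L · L') x = ∃[ a ] ∃[ b ] (x ≡ a ++ b × L a × L' b)

  data Star (L : Lang q) : Lang q where
    ε∈ : Star L []
    _∷ₛ_ : ∀ {a b} → L a → Star L b → Star L (a ++ b)

  _w⁻[_] : Lang q → Word q → Lang q
  (L w⁻[ w ]) x = L (x ++ w)

  Plus : Lang q
  Plus x = x ≢ []

  _≐_ : Lang q → Lang q → Set
  L ≐ L' = ∀ x → (L x → L' x) × (L' x → L x)

  OccAt : Word q → Word q → Word q → Word q → Set
  OccAt w x u v = x ≡ u ++ w ++ v

  Occurs : Word q → Word q → Set
  Occurs w x = ∃[ u ] ∃[ v ] OccAt w x u v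

  EndsWith : Word q → Word q → Set
  EndsWith w x = ∃[ u ] (x ≡ u ++ w)

  AutoC : Word q → Lang q
  AutoC w e = length e < length w × EndsWith w (w ++ e)

  AutoC∘ : Word q → Lang q
  AutoC∘ w = AutoC w ∖ Sing []

  KCode : Word q → Lang q
  KCode w = AutoC∘ w ∖ (AutoC∘ w · Plus)

  RightL : Word q → Lang q
  RightL w r = EndsWith w r × (∀ u v → OccAt w r u v → v ≡ [])

  MinL : Word q → Lang q
  MinL w m = m ≢ [] × EndsWith w (w ++ m)
           × (∀ u v → OccAt w (w ++ m) u v → u ≡ [] ⊎ v ≡ [])

  UltL : Word q → Lang q
  UltL w u = ∀ a b → OccAt w (w ++ u) a b → a ≡ []

  NotL : Word q → Lang q
  NotL w n = ¬ Occurs w n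

module Submission where

-- A word x either avoids w, or factors at the leftmost occurrence of w as x = p w y with p w ∈ ℛ.
-- Scanning w y from left to right, each next occurrence of w either overlaps the previous one,
-- which contributes a nonempty e ∈ 𝒞 (w e ends with w), or starts after it, which contributes
-- a word m with m w ∈ ℳ; such an m w is never in 𝒦, since 𝒦 ⊆ 𝒞 only holds words shorter than w.
-- Once no further occurrence exists, the rest of the word lies in 𝒰.

open import Defs
open import Data.Nat using (ℕ; _+_; _≤_; _<_; z≤n; s≤s; z<s)
open import Data.Nat.Induction using (<-wellFounded)
open import Data.Nat.Properties
  using (<-irrefl; ≤⇒≯; <⇒≱; ≤-<-trans; <-≤-trans; +-monoʳ-<; +-cancelʳ-<; m<m+n; module ≤-Reasoning)
open import Data.Fin using (Fin; _≟_)
open import Data.List using (List; []; _∷_; _++_; length)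
open import Data.List.Properties
  using (++-assoc; length-++; length-++-≤ˡ; length-++-≤ʳ; ∷-injective; ∷-injectiveʳ;
         ++-identityʳ; ++-identityˡ-unique; ++-conicalʳ)
open import Data.List.Relation.Binary.Prefix.Heterogeneous.Properties using (prefix?)
open import Data.List.Relation.Binary.Prefix.Propositional.Properties using (Prefix-as-∣ˡ; ∣ˡ-as-Prefix)
open import Data.Product using (∃; ∃₂; _×_; _,_)
open import Data.Sum using (_⊎_; inj₁; inj₂)
open import Data.Unit using (tt)
open import Data.Empty using (⊥-elim)
open import Function using (case_of_)
open import Induction.WellFounded using (Acc; acc)
open import Relation.Nullary using (¬_; Dec; yes; no)
open import Relation.Nullary.Decidable using (map′)
open import Relation.Unary using (_⊆_; _⊇_)
open import Relation.Binary.PropositionalEquality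
  using (_≡_; _≢_; refl; sym; trans; cong; subst; module ≡-Reasoning)

module _ {A : Set} where

  ++-levi : ∀ (xs ys us vs : List A) → xs ++ ys ≡ us ++ vs →
    (∃ λ t → us ≡ xs ++ t × ys ≡ t ++ vs) ⊎ (∃ λ t → t ≢ [] × xs ≡ us ++ t × vs ≡ t ++ ys)
  ++-levi []       ys us       vs eq = inj₁ (us , refl , eq)
  ++-levi (x ∷ xs) ys []       vs eq = inj₂ (x ∷ xs , (λ ()) , refl , sym eq)
  ++-levi (x ∷ xs) ys (u ∷ us) vs eq with ∷-injective eq
  ... | refl , eq′ with ++-levi xs ys us vs eq′
  ...   | inj₁ (t , us≡ , ys≡)          = inj₁ (t , cong (x ∷_) us≡ , ys≡)
  ...   | inj₂ (t , t≢[] , xs≡ , vs≡) = inj₂ (t , t≢[] , cong (x ∷_) xs≡ , vs≡)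

  length-++-<ʳ : ∀ (xs ys : List A) → xs ≢ [] → length ys < length (xs ++ ys)
  length-++-<ʳ []       ys []≢[] = ⊥-elim ([]≢[] refl)
  length-++-<ʳ (x ∷ xs) ys _     = s≤s (length-++-≤ʳ ys {xs})

  prefix-length-< : ∀ (p u w : List A) {a v} → p ++ w ≡ u ++ w ++ a ∷ v → length u < length p
  prefix-length-< p u w {a} {v} eq = +-cancelʳ-< (length w) (length u) (length p) (begin-strict
    length u + length w                    <⟨ +-monoʳ-< (length u) (m<m+n (length w) z<s) ⟩
    length u + (length w + length (a ∷ v)) ≡⟨ cong (length u +_) (sym (length-++ w)) ⟩
    length u + length (w ++ a ∷ v)         ≡⟨ sym (length-++ u) ⟩
    length (u ++ w ++ a ∷ v)               ≡⟨ cong length (sym eq) ⟩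
    length (p ++ w)                        ≡⟨ length-++ p ⟩
    length p + length w                    ∎)
    where open ≤-Reasoning

module _ {q : ℕ} {L L′ L″ : Lang q} where

  ·-assoc : (L · L′) · L″ ⊇ L · (L′ · L″)
  ·-assoc (a , _ , refl , la , (b , c , refl , lb , lc)) =
    a ++ b , c , sym (++-assoc a b c) , (a , b , refl , la , lb) , lc

module _ {q : ℕ} {L L′ : Lang q} where

  Star-·-[] : L′ ⊆ Star L · L′
  Star-·-[] {x} l′ = [] , x , refl , ε∈ , l′

  Star-·-∷ : L · (Star L · L′) ⊆ Star L · L′
  Star-·-∷ (a , _ , refl , la , (s , r , refl , ls , l′)) =
    a ++ s , r , sym (++-assoc a s r) , la ∷ₛ ls , l′

module _ {q : ℕ} where

  isPrefix? : (w x : Word q) → Dec (∃ λ y → w ++ y ≡ x)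
  isPrefix? w x = map′
    (λ pre → case Prefix-as-∣ˡ pre of λ { record { quotient = y ; equality = eq } → y , eq })
    (λ (y , eq) → ∣ˡ-as-Prefix record { quotient = y ; equality = eq })
    (prefix? _≟_ w x)

  NoOccurrenceBefore : Word q → Word q → Word q → Set
  NoOccurrenceBefore w x p = ∀ u v → OccAt w x u v → length p ≤ length u

  leftmost-occurrence : ∀ w x → NotL w x ⊎ ∃₂ λ p y → OccAt w x p y × NoOccurrenceBefore w x p
  leftmost-occurrence w x with isPrefix? w x
  ... | yes (y , eq) = inj₂ ([] , y , sym eq , λ _ _ _ → z≤n)
  leftmost-occurrence w [] | no ¬prefix =
    inj₁ λ { ([] , v , eq) → ¬prefix (v , sym eq) ; (_ ∷ _ , _ , ()) }
  leftmost-occurrence w (a ∷ x) | no ¬prefix with leftmost-occurrence w x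
  ... | inj₁ none = inj₁ λ { ([] , v , eq) → ¬prefix (v , sym eq)
                           ; (_ ∷ u , v , eq) → none (u , v , ∷-injectiveʳ eq) }
  ... | inj₂ (p , y , occ , first) = inj₂ (a ∷ p , y , cong (a ∷_) occ ,
          λ { [] v eq → ⊥-elim (¬prefix (v , sym eq))
            ; (_ ∷ u) v eq → s≤s (first u v (∷-injectiveʳ eq)) })

  leftmost-prefix-right : ∀ {w x p y} → OccAt w x p y → NoOccurrenceBefore w x p → RightL w (p ++ w)
  leftmost-prefix-right {w} {x} {p} {y} occ first = (p , refl) , only-suffix
    where
    only-suffix : ∀ u v → OccAt w (p ++ w) u v → v ≡ []
    only-suffix u []      _  = refl
    only-suffix u (a ∷ v) eq =
      ⊥-elim (≤⇒≯ (first u ((a ∷ v) ++ y) earlier) (prefix-length-< p u w eq))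
      where
      open ≡-Reasoning
      earlier : OccAt w x u ((a ∷ v) ++ y)
      earlier = begin
        x                            ≡⟨ occ ⟩
        p ++ w ++ y                  ≡⟨ sym (++-assoc p w y) ⟩
        (p ++ w) ++ y                ≡⟨ cong (_++ y) eq ⟩
        (u ++ w ++ a ∷ v) ++ y       ≡⟨ ++-assoc u (w ++ a ∷ v) y ⟩
        u ++ (w ++ a ∷ v) ++ y       ≡⟨ cong (u ++_) (++-assoc w (a ∷ v) y) ⟩
        u ++ w ++ (a ∷ v) ++ y       ∎

  residual∉KCode : ∀ (w m : Word q) → ¬ KCode w (m ++ w)
  residual∉KCode w m (((shorter , _) , _) , _) = <⇒≱ shorter (length-++-≤ʳ w {m})

  gap-or-overlap : ∀ (w P y b : Word q) → P ≢ [] → w ++ y ≡ P ++ w ++ b →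
    (∃ λ m → P ≡ w ++ m × y ≡ m ++ w ++ b) ⊎ (∃ λ e → e ≢ [] × AutoC w e × y ≡ e ++ b)
  gap-or-overlap w P y b P≢[] eq with ++-levi w y P (w ++ b) eq
  ... | inj₁ gap = inj₁ gap
  ... | inj₂ (t , t≢[] , w≡Pt , wb≡ty) with ++-levi t y w b (sym wb≡ty)
  ...   | inj₁ (e , w≡te , y≡eb) = inj₂ (e , e≢[] , (shorter , (P , ends)) , y≡eb)
    where
    open ≡-Reasoning
    e≢[] : e ≢ []
    e≢[] refl = P≢[] (++-identityˡ-unique P (trans (sym (trans w≡te (++-identityʳ t))) w≡Pt))
    shorter : length e < length w
    shorter = subst (λ z → length e < length z) (sym w≡te) (length-++-<ʳ t e t≢[])
    ends : w ++ e ≡ P ++ w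
    ends = begin
      w ++ e          ≡⟨ cong (_++ e) w≡Pt ⟩
      (P ++ t) ++ e   ≡⟨ ++-assoc P t e ⟩
      P ++ t ++ e     ≡⟨ cong (P ++_) (sym w≡te) ⟩
      P ++ w          ∎
  ...   | inj₂ (s , _ , t≡ws , _) =
    ⊥-elim (<-irrefl (cong length (trans w≡Pt (cong (P ++_) t≡ws)))
                     (≤-<-trans (length-++-≤ˡ w) (length-++-<ʳ P (w ++ s) P≢[])))

module Decomposition {q : ℕ} (c : Fin q) (w′ : Word q) where

  w : Word q
  w = c ∷ w′

  AutoC⋆ : Lang q
  AutoC⋆ = Star (AutoC w)

  Block : Lang q
  Block = ((MinL w ∖ KCode w) w⁻[ w ]) · (Sing w · AutoC⋆)

  After : Lang q
  After = AutoC⋆ · (Star Block · UltL w)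

  NotL⇒UltL : ∀ {y} → NotL w (w′ ++ y) → UltL w y
  NotL⇒UltL none []      b _  = refl
  NotL⇒UltL none (_ ∷ a) b eq = ⊥-elim (none (a , b , ∷-injectiveʳ eq))

  RightL⇒MinL : ∀ m → RightL w (w′ ++ m ++ w) → MinL w (m ++ w)
  RightL⇒MinL m (_ , only-suffix) =
    (λ mw≡[] → case ++-conicalʳ m w mw≡[] of λ ()) , (w ++ m , sym (++-assoc w m w)) , inner
    where
    inner : ∀ u v → OccAt w (w ++ m ++ w) u v → u ≡ [] ⊎ v ≡ []
    inner []      v       _  = inj₁ refl
    inner (_ ∷ u) []      _  = inj₂ refl
    inner (_ ∷ u) (a ∷ v) eq = case only-suffix u (a ∷ v) (∷-injectiveʳ eq) of λ ()

  after : ∀ y → Acc _<_ (length y) → After y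
  after y (acc rs) with leftmost-occurrence w (w′ ++ y)
  ... | inj₁ none = Star-·-[] (Star-·-[] (NotL⇒UltL none))
  ... | inj₂ (p , b , occ , first) with gap-or-overlap w (c ∷ p) y b (λ ()) (cong (c ∷_) occ)
  ...   | inj₁ (m , refl , refl) =
    Star-·-[] (Star-·-∷ (·-assoc (m , w ++ b , refl , (mw∈ℳ , residual∉KCode w m) ,
      ·-assoc (w , b , refl , refl , after b (rs b<y)))))
    where
    mw∈ℳ : MinL w (m ++ w)
    mw∈ℳ = RightL⇒MinL m (subst (RightL w) (++-assoc w′ m w) (leftmost-prefix-right occ first))
    b<y : length b < length (m ++ w ++ b)
    b<y = <-≤-trans (length-++-<ʳ w b (λ ())) (length-++-≤ʳ (w ++ b) {m})
  ...   | inj₂ (e , e≢[] , e∈𝒞 , refl) =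
    Star-·-∷ (e , b , refl , e∈𝒞 , after b (rs (length-++-<ʳ e b e≢[])))

  decomposition : ∀ x → (NotL w ∪ ((((RightL w w⁻[ w ]) · (Sing w · AutoC⋆)) · Star Block) · UltL w)) x
  decomposition x with leftmost-occurrence w x
  ... | inj₁ none = inj₁ none
  ... | inj₂ (p , y , refl , first) =
    inj₂ (·-assoc (·-assoc (p , w ++ y , refl , leftmost-prefix-right refl first ,
      ·-assoc (w , y , refl , refl , after y (<-wellFounded (length y))))))

lemma3 : (q : ℕ) (w : Word q) → w ≢ [] →
    Full ≐ (NotL w ∪
      ((((RightL w w⁻[ w ]) · (Sing w · Star (AutoC w)))
        · Star (((MinL w ∖ KCode w) w⁻[ w ]) · (Sing w · Star (AutoC w))))
        · UltL w))
lemma3 q []       w≢[] = ⊥-elim (w≢[] refl)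
lemma3 q (c ∷ w′) _    x = (λ _ → Decomposition.decomposition c w′ x) , λ _ → tt
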